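{- Let $(X,\mathcal{T})$ be a topological space and let $\mathcal{C}$ be the family of closed subsets of $X$. Then the closed topological frame $\langle X\dot{\times}\mathcal{C},R_\Box,R_{\mathsf{K}}\rangle$ satisfies conditions (C1)–(C8), with $R_1=R_\Box$ and $R_2=R_{\mathsf{K}}$.
   Context: For a subset space $(X,\mathcal{O})$ ($\mathcal{O}\subseteq\mathcal{P}(X)$, $X\in\mathcal{O}$), let $X\dot{\times}\mathcal{O}=\{(x,U): U\in\mathcal{O}, x\in U\}$; its subset frame is $\langle X\dot{\times}\mathcal{O},R_\Box,R_{\mathsf{K}}\rangle$ where $(x,U)R_\Box(y,V)$ iff $x=y$ and $V\subseteq U$, and $(x,U)R_{\mathsf{K}}(y,V)$ iff $U=V$. When $\mathcal{O}$ is the family of closed sets of a topology, this is called a closed topological frame. For a frame $\langle S,R_1,R_2\rangle$ write $s\,R_1R_2\,t$ if there is $r$ with $sR_1r$ and $rR_2t$, and similarly $s\,R_2R_1\,t$. Conditions: (C1) $R_1$ is reflexive and transitive. (C2) $R_2$ is an equivalence relation. (C3) for all $s,t$, if $s\,R_1R_2\,t$ then $s\,R_2R_1\,t$. (C4) for every $s$ there is $s_0$ such that for all $s'$, $sR_1s'$ implies $s'R_1s_0$. (C5) for all $s,s'$: if there is $s_0$ with $sR_1s_0$ and $s'R_1s_0$, and for every $t$ with $tR_2s$ there are $t',t_0$ with $t'R_2s'$, $tR_1t_0$, $t'R_1t_0$, and for every $t'$ with $t'R_2s'$ there are $t,t_0$ with $tR_2s$, $t'R_1t_0$, $tR_1t_0$,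 then $s=s'$. (C6) for all $s_1,s_2$: if there is $s$ with $s\,R_2R_1\,s_1$ and $s\,R_2R_1\,s_2$, then there is $s'$ such that every $t$ with $tR_2s'$ satisfies $t\,R_1R_2\,s_1$ or $t\,R_1R_2\,s_2$. (C7) for every family $\{s_i\}_{i\in I}$: if there is $s$ with $s_iR_1s$ for all $i$, then there is $s'$ such that for every family $\{t_i\}_{i\in I}$ with $t_iR_2s_i$ for all $i$ and $t_iR_1t_0$ for all $i$ for some $t_0$, we have $t_i\,R_1R_2\,s'$ for all $i$. (C8) there is $s$ such that $s\,R_2R_1\,s'$ for all $s'$. -}

module Defs where

open import Level using (Level; _⊔_; suc; Lift)
open import Data.Product using (Σ; ∃; ∃₂; _×_; _,_)
open import Data.Sum using (_⊎_)
open import Data.Unit using (⊤)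
open import Relation.Unary using (Pred; _⊆_; _≐_; _∩_; ∁)
open import Relation.Binary.Core using (Rel)
open import Relation.Binary.Definitions using (Reflexive; Transitive)
open import Relation.Binary.Structures using (IsEquivalence)
open import Relation.Binary.PropositionalEquality using (_≡_)

-- Abstract bimodal frames ⟨S, R₁, R₂⟩, with an explicit equality _≈_ on
-- states (used for the "s = s'" in (C5)).

module FrameConditions {s e r₁ r₂ : Level} {S : Set s}
  (_≈_ : Rel S e) (R₁ : Rel S r₁) (R₂ : Rel S r₂) where

  R₁R₂ : Rel S (s ⊔ r₁ ⊔ r₂)
  R₁R₂ a b = ∃ λ c → R₁ a c × R₂ c b

  R₂R₁ : Rel S (s ⊔ r₁ ⊔ r₂)
  R₂R₁ a b = ∃ λ c → R₂ a c × R₁ c b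

  C1 : Set _
  C1 = Reflexive R₁ × Transitive R₁

  C2 : Set _
  C2 = IsEquivalence R₂

  C3 : Set _
  C3 = ∀ a b → R₁R₂ a b → R₂R₁ a b

  C4 : Set _
  C4 = ∀ a → ∃ λ a₀ → ∀ a' → R₁ a a' → R₁ a' a₀

  C5 : Set _
  C5 = ∀ a a' →
       (∃ λ a₀ → R₁ a a₀ × R₁ a' a₀) →
       (∀ t → R₂ t a → ∃₂ λ t' t₀ → R₂ t' a' × R₁ t t₀ × R₁ t' t₀) →
       (∀ t' → R₂ t' a' → ∃₂ λ t t₀ → R₂ t a × R₁ t' t₀ × R₁ t t₀) →
       a ≈ a'

  C6 : Set _
  C6 = ∀ a₁ a₂ →
       (∃ λ a → R₂R₁ a a₁ × R₂R₁ a a₂) →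
       ∃ λ a' → ∀ t → R₂ t a' → R₁R₂ t a₁ ⊎ R₁R₂ t a₂

  C7 : (ι : Level) → Set _
  C7 ι = ∀ (I : Set ι) (f : I → S) →
         (∃ λ a → ∀ i → R₁ (f i) a) →
         ∃ λ a' → ∀ (g : I → S) →
           (∀ i → R₂ (g i) (f i)) →
           (∃ λ t₀ → ∀ i → R₁ (g i) t₀) →
           ∀ i → R₁R₂ (g i) a'

  C8 : Set _
  C8 = ∃ λ a → ∀ a' → R₂R₁ a a'

  C1-C8 : (ι : Level) → Set _
  C1-C8 ι = C1 × C2 × C3 × C4 × C5 × C6 × C7 ι × C8

-- Arbitrary unions are indexed by types in Set (suc ℓ)
-- (large enough for any subfamily of the topology).

record Topology {ℓ : Level} (X : Set ℓ) : Set (suc (suc ℓ)) where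
  field
    Open      : Pred X ℓ → Set ℓ
    Open-resp : ∀ {U V : Pred X ℓ} → U ≐ V → Open U → Open V
    Open-full : Open (λ _ → Lift ℓ ⊤)
    Open-∩    : ∀ {U V : Pred X ℓ} → Open U → Open V → Open (U ∩ V)
    Open-⋃    : (I : Set (suc ℓ)) (O : I → Pred X ℓ) → (∀ i → Open (O i)) →
                Σ (Pred X ℓ) λ V → Open V ×
                  (∀ x → (V x → ∃ λ i → O i x) × ((∃ λ i → O i x) → V x))

  Closed : Pred X ℓ → Set (suc ℓ)
  Closed C = Σ (Pred X ℓ) λ O → Open O × (C ≐ ∁ O)

module ClosedFrame {ℓ : Level} {X : Set ℓ} (T : Topology X) where
  open Topology T

  State : Set (suc ℓ)
  State = Σ X λ x → Σ (Pred X ℓ) λ U → Closed U × U x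

  point : State → X
  point (x , _) = x

  set : State → Pred X ℓ
  set (_ , U , _) = U

  _≈ₛ_ : Rel State ℓ
  a ≈ₛ b = point a ≡ point b × set a ≐ set b

  R□ : Rel State ℓ
  R□ a b = point a ≡ point b × set b ⊆ set a

  RK : Rel State ℓ
  RK a b = set a ≐ set b

{-# OPTIONS --safe #-}
-- Conditions (C1)–(C3), (C5) and (C6) hold in the subset frame of any family
-- of sets. The other three only need the family to be closed under arbitrary
-- intersections: the least member containing x is the R□-top state of (C4),
-- the intersection of the sets of the family is the set of s' in (C7), and the
-- empty intersection, the whole space, gives (C8). Closed sets of a topology
-- form such a family, since a union of open sets is open.
module Submission where

open import Defs
open import Level using (Level; suc)
open import Data.Empty.Polymorphic using (⊥)
open import Data.Product using (Σ; ∃; ∃₂; _×_; _,_; proj₁; proj₂)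
open import Data.Sum using (inj₁)
open import Function using (_∘_)
open import Relation.Unary using (Pred; _⊆_; _≐_; ⋂; ∁)
open import Relation.Unary.Properties using (⊆-refl; ≐-refl; ≐-sym; ≐-trans)
open import Relation.Binary.Core using (Rel)
open import Relation.Binary.Definitions using (Reflexive; Transitive)
open import Relation.Binary.PropositionalEquality using (_≡_; refl; sym; trans; subst)

reflexive⇒C6 : ∀ {s e r₁ r₂} {S : Set s} {_≈_ : Rel S e} {R₁ : Rel S r₁} {R₂ : Rel S r₂} →
               Reflexive R₁ → FrameConditions.C6 _≈_ R₁ R₂
reflexive⇒C6 R₁-refl a₁ _ _ = a₁ , λ t tR₂a₁ → inj₁ (t , R₁-refl , tR₂a₁)

-- ⋂ I C lives in a larger universe than the sets of the family, so closure
-- asks for a member extensionally equal to it.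
IntersectionClosed : ∀ {ℓ} {X : Set ℓ} → Pred (Pred X ℓ) (suc ℓ) → Set (suc (suc ℓ))
IntersectionClosed {ℓ} {X} 𝒪 = (I : Set (suc ℓ)) (C : I → Pred X ℓ) → (∀ i → 𝒪 (C i)) →
                               Σ (Pred X ℓ) λ D → 𝒪 D × D ≐ ⋂ I C

-- The definitions of ClosedFrame for an arbitrary family 𝒪; for 𝒪 = Closed T
-- they coincide definitionally with those of ClosedFrame T.
module SubsetFrame {ℓ : Level} {X : Set ℓ} (𝒪 : Pred (Pred X ℓ) (suc ℓ)) where

  State : Set (suc ℓ)
  State = Σ X λ x → Σ (Pred X ℓ) λ U → 𝒪 U × U x

  point : State → X
  point (x , _) = x

  set : State → Pred X ℓ
  set (_ , U , _) = U

  set∈𝒪 : (a : State) → 𝒪 (set a)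
  set∈𝒪 (_ , _ , U∈𝒪 , _) = U∈𝒪

  point∈set : (a : State) → set a (point a)
  point∈set (_ , _ , _ , x∈U) = x∈U

  moveTo : (a : State) {y : X} → set a y → State
  moveTo a {y} y∈U = y , set a , set∈𝒪 a , y∈U

  _≈ₛ_ : Rel State ℓ
  a ≈ₛ b = point a ≡ point b × set a ≐ set b

  R□ : Rel State ℓ
  R□ a b = point a ≡ point b × set b ⊆ set a

  RK : Rel State ℓ
  RK a b = set a ≐ set b

  open FrameConditions _≈ₛ_ R□ RK

  R□-refl : Reflexive R□
  R□-refl {a} = refl , ⊆-refl {x = set a}

  R□-trans : Transitive R□
  R□-trans (p , b⊆a) (q , c⊆b) = trans p q , b⊆a ∘ c⊆b

  RK-refl : Reflexive RK
  RK-refl {a} = ≐-refl {x = set a}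

  cobounded⇒point∈set : ∀ {a b c} → R□ a c → R□ b c → set a (point b)
  cobounded⇒point∈set {a} {c = c} (_ , c⊆a) (b≡c , _) =
    subst (set a) (sym b≡c) (c⊆a (point∈set c))

  c1 : C1
  c1 = (λ {a} → R□-refl {a}) , (λ {a} {b} {c} → R□-trans {a} {b} {c})

  c2 : C2
  c2 = record { refl = λ {a} → RK-refl {a} ; sym = ≐-sym ; trans = ≐-trans }

  c3 : C3
  c3 a c (b , (_ , b⊆a) , (_ , c⊆b)) =
    moveTo a (c⊆a (point∈set c)) , ≐-refl , refl , c⊆a
    where
    c⊆a : set c ⊆ set a
    c⊆a = b⊆a ∘ c⊆b

  K-cover⇒⊆ : ∀ a a' → (∀ t → RK t a → ∃₂ λ t' t₀ → RK t' a' × R□ t t₀ × R□ t' t₀) →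
              set a ⊆ set a'
  K-cover⇒⊆ a a' cover y∈a with cover (moveTo a y∈a) (RK-refl {a})
  ... | t' , t₀ , (t'⊆a' , _) , tR□t₀ , t'R□t₀ =
    t'⊆a' (cobounded⇒point∈set {t'} {moveTo a y∈a} {t₀} t'R□t₀ tR□t₀)

  c5 : C5
  c5 a a' (_ , (a≡a₀ , _) , (a'≡a₀ , _)) cover cover' =
    trans a≡a₀ (sym a'≡a₀) , K-cover⇒⊆ a a' cover , K-cover⇒⊆ a' a cover'

  c6 : C6
  c6 = reflexive⇒C6 {_≈_ = _≈ₛ_} (λ {a} → R□-refl {a})

  module _ (⋂-closed : IntersectionClosed 𝒪) where

    leastContaining : (x : X) → Σ (Pred X ℓ) λ K → 𝒪 K × K x × (∀ {U} → 𝒪 U → U x → K ⊆ U)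
    leastContaining x with ⋂-closed (Σ (Pred X ℓ) λ U → 𝒪 U × U x) proj₁ (proj₁ ∘ proj₂)
    ... | K , K∈𝒪 , K⊆⋂ , ⋂⊆K =
      K , K∈𝒪 , ⋂⊆K (λ (_ , _ , x∈U) → x∈U) , λ {U} U∈𝒪 x∈U y∈K → K⊆⋂ y∈K (U , U∈𝒪 , x∈U)

    everything : Σ (Pred X ℓ) λ D → 𝒪 D × ∀ x → D x
    everything with ⋂-closed ⊥ (λ ()) (λ ())
    ... | D , D∈𝒪 , _ , ⋂⊆D = D , D∈𝒪 , λ _ → ⋂⊆D (λ ())

    c4 : C4
    c4 a with leastContaining (point a)
    ... | K , K∈𝒪 , x∈K , K-least =
      (point a , K , K∈𝒪 , x∈K) ,
      λ a' (a≡a' , _) → sym a≡a' , K-least (set∈𝒪 a') (subst (set a') (sym a≡a') (point∈set a'))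

    c7 : C7 (suc ℓ)
    c7 I f (a , fR□a) with ⋂-closed I (set ∘ f) (set∈𝒪 ∘ f)
    ... | D , D∈𝒪 , D⊆⋂ , ⋂⊆D = a' , K-below
      where
      a' : State
      a' = point a , D , D∈𝒪 , ⋂⊆D λ i → proj₂ (fR□a i) (point∈set a)
      K-below : ∀ g → (∀ i → RK (g i) (f i)) → (∃ λ t₀ → ∀ i → R□ (g i) t₀) →
                ∀ i → R₁R₂ (g i) a'
      K-below g gRKf (t₀ , gR□t₀) i =
        moveTo a' (⋂⊆D λ j → proj₁ (gRKf j)
                               (cobounded⇒point∈set {g j} {g i} {t₀} (gR□t₀ j) (gR□t₀ i))) ,
        (refl , λ y∈D → proj₂ (gRKf i) (D⊆⋂ y∈D i)) ,
        ≐-refl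

    c8 : X → C8
    c8 x₀ with everything
    ... | D , D∈𝒪 , everywhere =
      (x₀ , D , D∈𝒪 , everywhere x₀) ,
      λ a' → (point a' , D , D∈𝒪 , everywhere (point a')) , ≐-refl , refl , λ _ → everywhere _

    c1-c8 : X → C1-C8 (suc ℓ)
    c1-c8 x₀ = c1 , c2 , c3 , c4 , c5 , c6 , c7 , c8 x₀

Closed-⋂ : ∀ {ℓ} {X : Set ℓ} (T : Topology X) → IntersectionClosed (Topology.Closed T)
Closed-⋂ T I C C-closed with Topology.Open-⋃ T I (proj₁ ∘ C-closed) (proj₁ ∘ proj₂ ∘ C-closed)
... | V , V-open , V≐⋃ = ∁ V , (V , V-open , ≐-refl) , ∁V⊆⋂ , ⋂⊆∁V
  where
  C≐∁O : ∀ i → C i ≐ ∁ (proj₁ (C-closed i))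
  C≐∁O i = proj₂ (proj₂ (C-closed i))
  ∁V⊆⋂ : ∁ V ⊆ ⋂ I C
  ∁V⊆⋂ {x} x∉V i = proj₂ (C≐∁O i) λ x∈Oᵢ → x∉V (proj₂ (V≐⋃ x) (i , x∈Oᵢ))
  ⋂⊆∁V : ⋂ I C ⊆ ∁ V
  ⋂⊆∁V {x} x∈⋂ x∈V with proj₁ (V≐⋃ x) x∈V
  ... | i , x∈Oᵢ = proj₁ (C≐∁O i) (x∈⋂ i) x∈Oᵢ

mainTheorem8 : {ℓ : Level} {X : Set ℓ} (T : Topology X) → X →
    FrameConditions.C1-C8 (ClosedFrame._≈ₛ_ T) (ClosedFrame.R□ T) (ClosedFrame.RK T) (suc ℓ)
mainTheorem8 T = SubsetFrame.c1-c8 (Topology.Closed T) (Closed-⋂ T)
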